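{- Let $u$ be a vertex of $T$ and let $z'$ be the least common ancestor, in $t'$, of the leaf vertices in $L(u)$. Suppose all counters have been cleared to $0$ and then UpdateCounterSubtree($u$) is called. Then the leaf set $L(u)$ is compatible with the current $t'$ if and only if $counter(z')=|L(u)|$.
   Context: $T$ and $t'$ are rooted trees on the same leaf set. For a vertex $w$, $L(w)$ is the set of leaves in the subtree rooted at $w$ (in $t'$ this is also written $L_{t'}(w)$), $size(w)=|L(w)|$, and $par(w)$ is the parent of $w$. A leaf set $S$ is compatible with $t'$ if there is a node $w$ of $t'$ such that for every child $v$ of $w$, either $L(v)\cap S=\emptyset$ or $L(v)\subseteq S$. Each vertex of $t'$ carries a variable $counter$; ClearCounter resets all counters to $0$. UpdateCounterLeaf($v,t'$) sets $counter(v)\leftarrow 1$ and then, while $counter(v)=size(v)$, sets $p\leftarrow par(v)$, $counter(p)\leftarrow counter(p)+counter(v)$, $v\leftarrow p$; finally it returns $v$. After this call the leaf $v$ is said to have been added. UpdateCounterSubtree($u$) calls UpdateCounterLeaf($v,t'$) for every leaf $v\in L(u)$ and returns the returned vertex of minimum depth. The counters then satisfy: for a leaf $v$ of $t'$, $counter(v)=1$ if $v$ has been added and $0$ otherwise; for an internal vertex $w$, $counter(w)=\sum_{v\in child(w)} counter(v)$ over those children with $counter(v)=|L(v)|$ (other children contribute $0$). -}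

module Defs where

open import Data.Nat using (ℕ; zero; suc; _+_; _≟_)
open import Data.Bool using (Bool; true; false; if_then_else_)
open import Data.List using (List; []; _∷_; _++_; [_]; length; reverse; foldl)
open import Data.List.Properties using (≡-dec)
open import Data.List.Relation.Unary.All using (All)
open import Data.List.Relation.Binary.Subset.Propositional using (_⊆_)
open import Data.List.Relation.Binary.Disjoint.Propositional using (Disjoint)
open import Data.List.Membership.Propositional using (_∈_)
open import Data.Maybe using (Maybe; just; nothing)
open import Data.Product using (Σ; _×_; _,_; ∃)
open import Data.Sum using (_⊎_)
open import Relation.Nullary using (yes; no)
open import Relation.Nullary.Decidable using (⌊_⌋)
open import Relation.Binary.PropositionalEquality using (_≡_)

data Tree : Set where
  leaf : ℕ → Tree
  node : List Tree → Tree

data WF : Tree → Set where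
  wf-leaf : ∀ a → WF (leaf a)
  wf-node : ∀ t ts → All WF (t ∷ ts) → WF (node (t ∷ ts))

mutual
  leaves : Tree → List ℕ
  leaves (leaf a)  = [ a ]
  leaves (node ts) = leavesL ts

  leavesL : List Tree → List ℕ
  leavesL []       = []
  leavesL (t ∷ ts) = leaves t ++ leavesL ts

-- Vertices are addressed by paths from the root (list of child indices).

Path : Set
Path = List ℕ

mutual
  sub : Tree → Path → Maybe Tree
  sub t        []      = just t
  sub (leaf _) (_ ∷ _) = nothing
  sub (node ts) (i ∷ p) = subL ts i p

  subL : List Tree → ℕ → Path → Maybe Tree
  subL []       _       _ = nothing
  subL (t ∷ ts) zero    p = sub t p
  subL (t ∷ ts) (suc i) p = subL ts i p

IsVertex : Tree → Path → Set
IsVertex t p = ∃ λ s → sub t p ≡ just s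

-- L(w) as a list of labels (empty if w is not a vertex)
L : Tree → Path → List ℕ
L t p with sub t p
... | just s  = leaves s
... | nothing = []

size : Tree → Path → ℕ
size t p = length (L t p)

LeafAt : Tree → Path → ℕ → Set
LeafAt t p a = sub t p ≡ just (leaf a)

-- ancestor relation (reflexive): p is an ancestor of q
Ancestor : Path → Path → Set
Ancestor p q = ∃ λ r → p ++ r ≡ q

IsCommonAncestor : Tree → List ℕ → Path → Set
IsCommonAncestor t S z =
  IsVertex t z × (∀ a p → a ∈ S → LeafAt t p a → Ancestor z p)

IsLCA : Tree → List ℕ → Path → Set
IsLCA t S z =
  IsCommonAncestor t S z × (∀ y → IsCommonAncestor t S y → Ancestor y z)

Compatible : List ℕ → Tree → Set
Compatible S t =
  Σ Path λ w → IsVertex t w × (S ⊆ L t w) ×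
    (∀ i → IsVertex t (w ++ [ i ]) →
       Disjoint (L t (w ++ [ i ])) S ⊎ (L t (w ++ [ i ]) ⊆ S))

Counter : Set
Counter = Path → ℕ

ClearCounter : Counter
ClearCounter _ = 0

setC : Counter → Path → ℕ → Counter
setC c p n q = if ⌊ ≡-dec _≟_ q p ⌋ then n else c q

-- The while loop of UpdateCounterLeaf.  The current vertex is given by its
-- path in reversed order (so that its parent is obtained by dropping the
-- head).  At the root the loop stops (the root has no parent).
climb : Tree → List ℕ → Counter → Path × Counter
climb t []        c = ([] , c)
climb t (i ∷ rp)  c with c (reverse (i ∷ rp)) ≟ size t (reverse (i ∷ rp))
... | yes _ = climb t rp (setC c (reverse rp) (c (reverse rp) + c (reverse (i ∷ rp))))
... | no  _ = (reverse (i ∷ rp) , c)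

UpdateCounterLeaf : Tree → Path → Counter → Path × Counter
UpdateCounterLeaf t v c = climb t (reverse v) (setC c v 1)

-- position in t of the (first) leaf labelled a
mutual
  leafPos : Tree → ℕ → Maybe Path
  leafPos (leaf b) a = if ⌊ b ≟ a ⌋ then just [] else nothing
  leafPos (node ts) a = leafPosL ts 0 a

  leafPosL : List Tree → ℕ → ℕ → Maybe Path
  leafPosL []       _ _ = nothing
  leafPosL (t ∷ ts) i a with leafPos t a
  ... | just p  = just (i ∷ p)
  ... | nothing = leafPosL ts (suc i) a

-- UpdateCounterSubtree(u): call UpdateCounterLeaf for each leaf of L(u)
-- (u given by its subtree in T), on the corresponding leaf of t'.
-- Only the resulting counters are returned.
UpdateCounterSubtree : Tree → Tree → Counter → Counter
UpdateCounterSubtree t' u c0 = foldl step c0 (leaves u)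
  where
  step : Counter → ℕ → Counter
  step c a with leafPos t' a
  ... | just v  = Data.Product.proj₂ (UpdateCounterLeaf t' v c)
  ... | nothing = c

module Submission where

-- Every counter can be predicted from the set B of leaves added so
-- far: a leaf has counter [a ∈ B], an internal vertex the sum of the counters of
-- its "full" children (counter = number of leaves); this is `expected B s`.
--
--  1. `expected B s` equals the number of leaves of s exactly when all of
--     them lie in B, and for a node it is the number of leaves lying in full
--     children (`fullLeaves`).
--  2. Counter invariant: UpdateCounterLeaf for a fresh leaf a turns counters
--     predicted for B into counters predicted for a ∷ B.  While climbing, the
--     proper ancestors of the current vertex still carry the old values and
--     all other vertices the new ones (`ClimbInv`).  Hence, after
--     ClearCounter and UpdateCounterSubtree(u), counter(z') = expected S x,
--     where S = L(u) and x is the subtree of t' at z'.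
--  3. Counting criterion: for S ⊆ L(x) without repetitions, expected S x = |S|
--     iff every child of x is disjoint from S or contained in S.
--  4. Since z' is the lca of S, compatibility of S with t' is equivalent to
--     that child condition at z' itself (a witness strictly above z' passes
--     its condition down to z').

open import Defs
open import Data.Nat using (ℕ; zero; suc; _+_; _≤_; z≤n; s≤s; _≟_)
open import Data.Nat.Properties
  using (≤-antisym; ≤-trans; ≤-reflexive; <-irrefl; +-suc; +-comm; +-assoc; +-identityʳ;
         +-cancelˡ-≡; +-cancelʳ-≤; +-monoʳ-≤; +-mono-≤; n≤0⇒n≡0; m+1+n≢m; module ≤-Reasoning)
open import Data.List using (List; []; _∷_; _++_; [_]; length; reverse; foldl; _ʳ++_)
open import Data.List.Properties using (∷-injective; ∷-injectiveʳ; ≡-dec; length-++; ++-identityʳ; ++-assoc; unfold-reverse; reverse-involutive)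
open import Data.List.Relation.Unary.Unique.Propositional using (Unique)
open import Data.List.Relation.Unary.AllPairs using ([]; _∷_)
open import Data.List.Relation.Unary.All using (All) renaming (lookup to All-lookup; tabulate to All-tabulate)
open import Data.List.Relation.Unary.Any using (here; there)
open import Data.List.Relation.Unary.Any.Properties using (reverse⁺; reverse⁻)
open import Data.List.Membership.Propositional using (_∈_; _∉_)
open import Data.List.Membership.Propositional.Properties using (∈-++⁺ˡ; ∈-++⁺ʳ; ∈-++⁻; ∈-∃++)
open import Data.List.Membership.DecPropositional _≟_ using (_∈?_)
open import Data.List.Relation.Binary.Subset.Propositional using (_⊆_)
open import Data.List.Relation.Binary.Disjoint.Propositional using (Disjoint)
open import Data.List.Relation.Binary.Permutation.Propositional using (_↭_)
open import Data.List.Relation.Binary.Permutation.Propositional.Properties using (∈-resp-↭)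
open import Data.Maybe using (just; nothing)
open import Data.Maybe.Properties using (just-injective)
open import Data.Product using (_×_; _,_; ∃; ∃₂; proj₂)
open import Data.Sum using (_⊎_; inj₁; inj₂)
open import Data.Empty using (⊥-elim)
open import Function using (_∘_)
open import Function.Bundles using (_⇔_; mk⇔)
import Function.Properties.Equivalence as ⇔
open import Relation.Nullary using (yes; no; ¬_)
open import Relation.Binary.PropositionalEquality
  using (_≡_; _≢_; refl; sym; trans; cong; cong₂; subst; module ≡-Reasoning)
import Data.List.Relation.Unary.All.Properties as AllP
import Data.List.Relation.Unary.Unique.Propositional.Properties as UniqueP

unique-++ˡ : ∀ (xs : List ℕ) {ys} → Unique (xs ++ ys) → Unique xs
unique-++ˡ []       u          = []
unique-++ˡ (x ∷ xs) (x∉ ∷ u) = AllP.++⁻ˡ xs x∉ ∷ unique-++ˡ xs u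

unique-++ʳ : ∀ (xs : List ℕ) {ys} → Unique (xs ++ ys) → Unique ys
unique-++ʳ []       u        = u
unique-++ʳ (x ∷ xs) (_ ∷ u) = unique-++ʳ xs u

unique-++-apart : ∀ (xs : List ℕ) {ys a} → Unique (xs ++ ys) → a ∈ xs → a ∉ ys
unique-++-apart (x ∷ xs) (x∉ ∷ u) (here refl) a∈ys = All-lookup x∉ (∈-++⁺ʳ xs a∈ys) refl
unique-++-apart (x ∷ xs) (_ ∷ u)  (there a∈xs)     = unique-++-apart xs u a∈xs

∈-delete : ∀ (us : List ℕ) {vs z x} → z ∈ us ++ x ∷ vs → z ≢ x → z ∈ us ++ vs
∈-delete []       (here refl) z≢x = ⊥-elim (z≢x refl)
∈-delete []       (there z∈)  _   = z∈
∈-delete (u ∷ us) (here refl) _   = here refl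
∈-delete (u ∷ us) (there z∈)  z≢x = there (∈-delete us z∈ z≢x)

unique-⊆⇒length≤ : ∀ (xs ys : List ℕ) → Unique xs → xs ⊆ ys → length xs ≤ length ys
unique-⊆⇒length≤ []       ys _          _     = z≤n
unique-⊆⇒length≤ (x ∷ xs) ys (x∉xs ∷ u) xs⊆ys with ∈-∃++ (xs⊆ys (here refl))
... | us , vs , refl = begin
    suc (length xs)              ≤⟨ s≤s (unique-⊆⇒length≤ xs (us ++ vs) u rest⊆) ⟩
    suc (length (us ++ vs))      ≡⟨ cong suc (length-++ us) ⟩
    suc (length us + length vs)  ≡⟨ sym (+-suc (length us) (length vs)) ⟩
    length us + length (x ∷ vs)  ≡⟨ sym (length-++ us) ⟩
    length (us ++ x ∷ vs)        ∎
  where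
  open ≤-Reasoning
  rest⊆ : xs ⊆ us ++ vs
  rest⊆ z∈ = ∈-delete us (xs⊆ys (there z∈)) (λ z≡x → All-lookup x∉xs z∈ (sym z≡x))

unique-⊆⊇⇒length≡ : ∀ (xs ys : List ℕ) → Unique xs → Unique ys → xs ⊆ ys → ys ⊆ xs →
                     length xs ≡ length ys
unique-⊆⊇⇒length≡ xs ys uxs uys xs⊆ys ys⊆xs =
  ≤-antisym (unique-⊆⇒length≤ xs ys uxs xs⊆ys) (unique-⊆⇒length≤ ys xs uys ys⊆xs)

mutual
  sub-++ : ∀ s w q {x} → sub s w ≡ just x → sub s (w ++ q) ≡ sub x q
  sub-++ s         []      q refl = refl
  sub-++ (leaf _)  (_ ∷ _) q ()
  sub-++ (node ts) (i ∷ w) q e    = subL-++ ts i w q e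

  subL-++ : ∀ ts i w q {x} → subL ts i w ≡ just x → subL ts i (w ++ q) ≡ sub x q
  subL-++ []       _       _ _ ()
  subL-++ (t ∷ ts) zero    w q e = sub-++ t w q e
  subL-++ (t ∷ ts) (suc i) w q e = subL-++ ts i w q e

mutual
  sub-++⁻ : ∀ s w q {y} → sub s (w ++ q) ≡ just y → ∃ λ x → sub s w ≡ just x × sub x q ≡ just y
  sub-++⁻ s         []      q e = s , refl , e
  sub-++⁻ (leaf _)  (_ ∷ _) q ()
  sub-++⁻ (node ts) (i ∷ w) q e = subL-++⁻ ts i w q e

  subL-++⁻ : ∀ ts i w q {y} → subL ts i (w ++ q) ≡ just y →
             ∃ λ x → subL ts i w ≡ just x × sub x q ≡ just y
  subL-++⁻ []       _       _ _ ()
  subL-++⁻ (t ∷ ts) zero    w q e = sub-++⁻ t w q e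
  subL-++⁻ (t ∷ ts) (suc i) w q e = subL-++⁻ ts i w q e

mutual
  sub-leaves : ∀ s r {x} → sub s r ≡ just x → leaves x ⊆ leaves s
  sub-leaves s         []      refl a∈ = a∈
  sub-leaves (leaf _)  (_ ∷ _) ()
  sub-leaves (node ts) (i ∷ r) e    a∈ = subL-leaves ts i r e a∈

  subL-leaves : ∀ ts i r {x} → subL ts i r ≡ just x → leaves x ⊆ leavesL ts
  subL-leaves []       _       _ ()
  subL-leaves (t ∷ ts) zero    r e a∈ = ∈-++⁺ˡ (sub-leaves t r e a∈)
  subL-leaves (t ∷ ts) (suc i) r e a∈ = ∈-++⁺ʳ (leaves t) (subL-leaves ts i r e a∈)

mutual
  sub-unique : ∀ s r {x} → sub s r ≡ just x → Unique (leaves s) → Unique (leaves x)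
  sub-unique s         []      refl u = u
  sub-unique (leaf _)  (_ ∷ _) ()
  sub-unique (node ts) (i ∷ r) e    u = subL-unique ts i r e u

  subL-unique : ∀ ts i r {x} → subL ts i r ≡ just x → Unique (leavesL ts) → Unique (leaves x)
  subL-unique []       _       _ ()
  subL-unique (t ∷ ts) zero    r e u = sub-unique t r e (unique-++ˡ (leaves t) u)
  subL-unique (t ∷ ts) (suc i) r e u = subL-unique ts i r e (unique-++ʳ (leaves t) u)

mutual
  leaf-path : ∀ s {a} → a ∈ leaves s → ∃ λ q → sub s q ≡ just (leaf a)
  leaf-path (leaf b)  (here refl) = [] , refl
  leaf-path (node ts) a∈ with leafL-path ts a∈
  ... | i , q , e = i ∷ q , e

  leafL-path : ∀ ts {a} → a ∈ leavesL ts → ∃₂ λ i q → subL ts i q ≡ just (leaf a)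
  leafL-path (t ∷ ts) a∈ with ∈-++⁻ (leaves t) a∈
  ... | inj₁ a∈t  = let q , e = leaf-path t a∈t in zero , q , e
  ... | inj₂ a∈ts = let i , q , e = leafL-path ts a∈ts in suc i , q , e

mutual
  leaf-path-unique : ∀ s {a} p q → Unique (leaves s) →
                     sub s p ≡ just (leaf a) → sub s q ≡ just (leaf a) → p ≡ q
  leaf-path-unique (leaf b)  []      []      u e₁ e₂ = refl
  leaf-path-unique (leaf b)  []      (_ ∷ _) u e₁ ()
  leaf-path-unique (leaf b)  (_ ∷ _) q       u () e₂
  leaf-path-unique (node ts) []      q       u () e₂
  leaf-path-unique (node ts) (_ ∷ _) []      u e₁ ()
  leaf-path-unique (node ts) (i ∷ p) (j ∷ q) u e₁ e₂ with leafL-path-unique ts i j p q u e₁ e₂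
  ... | refl , refl = refl

  leafL-path-unique : ∀ ts {a} i j p q → Unique (leavesL ts) →
                      subL ts i p ≡ just (leaf a) → subL ts j q ≡ just (leaf a) → i ≡ j × p ≡ q
  leafL-path-unique [] _ _ _ _ u ()
  leafL-path-unique (t ∷ ts) zero zero p q u e₁ e₂ =
    refl , leaf-path-unique t p q (unique-++ˡ (leaves t) u) e₁ e₂
  leafL-path-unique (t ∷ ts) zero (suc j) p q u e₁ e₂ =
    ⊥-elim (unique-++-apart (leaves t) u (sub-leaves t p e₁ (here refl)) (subL-leaves ts j q e₂ (here refl)))
  leafL-path-unique (t ∷ ts) (suc i) zero p q u e₁ e₂ =
    ⊥-elim (unique-++-apart (leaves t) u (sub-leaves t q e₂ (here refl)) (subL-leaves ts i p e₁ (here refl)))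
  leafL-path-unique (t ∷ ts) (suc i) (suc j) p q u e₁ e₂
    with leafL-path-unique ts i j p q (unique-++ʳ (leaves t) u) e₁ e₂
  ... | refl , refl = refl , refl

child-containing : ∀ ts {a} → a ∈ leavesL ts → ∃₂ λ i c → subL ts i [] ≡ just c × a ∈ leaves c
child-containing (t ∷ ts) a∈ with ∈-++⁻ (leaves t) a∈
... | inj₁ a∈t  = zero , t , refl , a∈t
... | inj₂ a∈ts = let i , c , e , a∈c = child-containing ts a∈ts in suc i , c , e , a∈c

child-of-node : ∀ s i {c} → sub s [ i ] ≡ just c → ∃ λ ts → s ≡ node ts × subL ts i [] ≡ just c
child-of-node (leaf _)  i ()
child-of-node (node ts) i e = ts , refl , e

L-sub : ∀ t p {s} → sub t p ≡ just s → L t p ≡ leaves s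
L-sub t p e rewrite e = refl

ProperAncestor : Path → Path → Set
ProperAncestor w x = ∃₂ λ i r → w ++ i ∷ r ≡ x

proper-irrefl : ∀ w → ¬ ProperAncestor w w
proper-irrefl w (i , r , e) = m+1+n≢m (length w) (trans (sym (length-++ w)) (cong length e))

no-proper-ancestor-of-root : ∀ {w} → ¬ ProperAncestor w []
no-proper-ancestor-of-root {[]}    (_ , _ , ())
no-proper-ancestor-of-root {_ ∷ _} (_ , _ , ())

proper-snoc⁻ : ∀ w p {i} → ProperAncestor w (p ++ [ i ]) → w ≡ p ⊎ ProperAncestor w p
proper-snoc⁻ []      []      _           = inj₁ refl
proper-snoc⁻ []      (k ∷ p) _           = inj₂ (k , p , refl)
proper-snoc⁻ (k ∷ w) []      (j , r , e) = ⊥-elim (no-proper-ancestor-of-root (j , r , ∷-injectiveʳ e))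
proper-snoc⁻ (k ∷ w) (k′ ∷ p) (j , r , e) with ∷-injective e
... | refl , e′ with proper-snoc⁻ w p (j , r , e′)
...   | inj₁ refl             = inj₁ refl
...   | inj₂ (j′ , r′ , e″) = inj₂ (j′ , r′ , cong (k ∷_) e″)

proper-snoc⁺ : ∀ w p {i} → ProperAncestor w p → ProperAncestor w (p ++ [ i ])
proper-snoc⁺ w p {i} (j , r , e) =
  j , r ++ [ i ] , trans (sym (++-assoc w (j ∷ r) [ i ])) (cong (_++ [ i ]) e)

setC-other : ∀ c p n q → q ≢ p → setC c p n q ≡ c q
setC-other c p n q q≢p with ≡-dec _≟_ q p
... | yes q≡p = ⊥-elim (q≢p q≡p)
... | no _    = refl

-- The predicted counters

nLeaves : Tree → ℕ
nLeaves s = length (leaves s)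

-- What a child with counter f and n leaves contributes to its parent's counter.
credit : ℕ → ℕ → ℕ
credit f n with f ≟ n
... | yes _ = f
... | no  _ = 0

credit-full : ∀ {f n} → f ≡ n → credit f n ≡ f
credit-full {f} {n} f≡n with f ≟ n
... | yes _  = refl
... | no f≢n = ⊥-elim (f≢n f≡n)

credit-partial : ∀ {f n} → f ≢ n → credit f n ≡ 0
credit-partial {f} {n} f≢n with f ≟ n
... | yes f≡n = ⊥-elim (f≢n f≡n)
... | no _    = refl

credit-≤ : ∀ {f n} → f ≤ n → credit f n ≤ n
credit-≤ {f} {n} f≤n with f ≟ n
... | yes _ = f≤n
... | no  _ = z≤n

credit-saturated : ∀ {f n} → f ≤ n → credit f n ≡ n → f ≡ n
credit-saturated {f} {n} f≤n c≡n with f ≟ n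
... | yes f≡n = f≡n
... | no  f≢n = ⊥-elim (f≢n (trans (n≤0⇒n≡0 (≤-trans f≤n (≤-reflexive (sym c≡n)))) c≡n))

mutual
  -- the counter of the root of s once exactly the leaves in B have been added
  expected : List ℕ → Tree → ℕ
  expected B (leaf a) with a ∈? B
  ... | yes _ = 1
  ... | no  _ = 0
  expected B (node ts) = expectedL B ts

  expectedL : List ℕ → List Tree → ℕ
  expectedL B []       = 0
  expectedL B (t ∷ ts) = credit (expected B t) (nLeaves t) + expectedL B ts

+-squeeze : ∀ {a b c d} → a ≤ c → b ≤ d → a + b ≡ c + d → a ≡ c × b ≡ d
+-squeeze {a} {b} {c} {d} a≤c b≤d sum≡ = a≡c , +-cancelˡ-≡ a b d (trans sum≡ (cong (_+ d) (sym a≡c)))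
  where
  c≤a : c ≤ a
  c≤a = +-cancelʳ-≤ d c a (≤-trans (≤-reflexive (sym sum≡)) (+-monoʳ-≤ a b≤d))
  a≡c : a ≡ c
  a≡c = ≤-antisym a≤c c≤a

mutual
  expected-≤ : ∀ B s → expected B s ≤ nLeaves s
  expected-≤ B (leaf a) with a ∈? B
  ... | yes _ = s≤s z≤n
  ... | no  _ = z≤n
  expected-≤ B (node ts) = expectedL-≤ B ts

  expectedL-≤ : ∀ B ts → expectedL B ts ≤ length (leavesL ts)
  expectedL-≤ B []       = z≤n
  expectedL-≤ B (t ∷ ts) = ≤-trans (+-mono-≤ (credit-≤ (expected-≤ B t)) (expectedL-≤ B ts))
                                   (≤-reflexive (sym (length-++ (leaves t))))

mutual
  full⇒⊆ : ∀ B s → expected B s ≡ nLeaves s → leaves s ⊆ B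
  full⇒⊆ B (leaf a) full with a ∈? B
  ... | yes a∈B = λ { (here refl) → a∈B }
  full⇒⊆ B (leaf a) () | no _
  full⇒⊆ B (node ts) full = fullL⇒⊆ B ts full

  fullL⇒⊆ : ∀ B ts → expectedL B ts ≡ length (leavesL ts) → leavesL ts ⊆ B
  fullL⇒⊆ B (t ∷ ts) full y∈ with +-squeeze (credit-≤ (expected-≤ B t)) (expectedL-≤ B ts)
                                             (trans full (length-++ (leaves t)))
  ... | credit≡ , rest≡ with ∈-++⁻ (leaves t) y∈
  ...   | inj₁ y∈t  = full⇒⊆ B t (credit-saturated (expected-≤ B t) credit≡) y∈t
  ...   | inj₂ y∈ts = fullL⇒⊆ B ts rest≡ y∈ts

mutual
  ⊆⇒full : ∀ B s → leaves s ⊆ B → expected B s ≡ nLeaves s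
  ⊆⇒full B (leaf a) s⊆B with a ∈? B
  ... | yes _   = refl
  ... | no  a∉B = ⊥-elim (a∉B (s⊆B (here refl)))
  ⊆⇒full B (node ts) s⊆B = ⊆⇒fullL B ts s⊆B

  ⊆⇒fullL : ∀ B ts → leavesL ts ⊆ B → expectedL B ts ≡ length (leavesL ts)
  ⊆⇒fullL B []       _     = refl
  ⊆⇒fullL B (t ∷ ts) ts⊆B = begin
      credit (expected B t) (nLeaves t) + expectedL B ts ≡⟨ cong (_+ expectedL B ts) (credit-full t-full) ⟩
      expected B t + expectedL B ts                      ≡⟨ cong₂ _+_ t-full (⊆⇒fullL B ts (ts⊆B ∘ ∈-++⁺ʳ (leaves t))) ⟩
      nLeaves t + length (leavesL ts)                    ≡⟨ sym (length-++ (leaves t)) ⟩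
      length (leaves t ++ leavesL ts)                    ∎
    where
    open ≡-Reasoning
    t-full : expected B t ≡ nLeaves t
    t-full = ⊆⇒full B t (ts⊆B ∘ ∈-++⁺ˡ)

mutual
  expected-cong : ∀ A B s → (∀ {x} → x ∈ leaves s → x ∈ A → x ∈ B) →
                  (∀ {x} → x ∈ leaves s → x ∈ B → x ∈ A) → expected A s ≡ expected B s
  expected-cong A B (leaf a) A⇒B B⇒A with a ∈? A | a ∈? B
  ... | yes _   | yes _   = refl
  ... | no  _   | no  _   = refl
  ... | yes a∈A | no  a∉B = ⊥-elim (a∉B (A⇒B (here refl) a∈A))
  ... | no  a∉A | yes a∈B = ⊥-elim (a∉A (B⇒A (here refl) a∈B))
  expected-cong A B (node ts) A⇒B B⇒A = expectedL-cong A B ts A⇒B B⇒A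

  expectedL-cong : ∀ A B ts → (∀ {x} → x ∈ leavesL ts → x ∈ A → x ∈ B) →
                   (∀ {x} → x ∈ leavesL ts → x ∈ B → x ∈ A) → expectedL A ts ≡ expectedL B ts
  expectedL-cong A B []       _   _   = refl
  expectedL-cong A B (t ∷ ts) A⇒B B⇒A =
    cong₂ _+_ (cong (λ f → credit f (nLeaves t)) (expected-cong A B t (A⇒B ∘ ∈-++⁺ˡ) (B⇒A ∘ ∈-++⁺ˡ)))
              (expectedL-cong A B ts (A⇒B ∘ ∈-++⁺ʳ (leaves t)) (B⇒A ∘ ∈-++⁺ʳ (leaves t)))

expected-fresh : ∀ A a s → a ∉ leaves s → expected (a ∷ A) s ≡ expected A s
expected-fresh A a s a∉s = expected-cong (a ∷ A) A s
  (λ { x∈s (here refl) → ⊥-elim (a∉s x∈s) ; _ (there x∈A) → x∈A }) (λ _ → there)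

credit-0 : ∀ n → credit 0 n ≡ 0
credit-0 n with 0 ≟ n
... | yes _ = refl
... | no  _ = refl

mutual
  expected-[] : ∀ s → expected [] s ≡ 0
  expected-[] (leaf a)  = refl
  expected-[] (node ts) = expectedL-[] ts

  expectedL-[] : ∀ ts → expectedL [] ts ≡ 0
  expectedL-[] []       = refl
  expectedL-[] (t ∷ ts) rewrite expected-[] t | expectedL-[] ts = cong (_+ 0) (credit-0 (nLeaves t))

fullLeaves : List ℕ → List Tree → List ℕ
fullLeaves B []       = []
fullLeaves B (t ∷ ts) with expected B t ≟ nLeaves t
... | yes _ = leaves t ++ fullLeaves B ts
... | no  _ = fullLeaves B ts

expectedL≡length-fullLeaves : ∀ B ts → expectedL B ts ≡ length (fullLeaves B ts)
expectedL≡length-fullLeaves B []       = refl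
expectedL≡length-fullLeaves B (t ∷ ts) with expected B t ≟ nLeaves t
... | yes full = trans (cong₂ _+_ full (expectedL≡length-fullLeaves B ts)) (sym (length-++ (leaves t)))
... | no  _    = expectedL≡length-fullLeaves B ts

fullLeaves-⊆-leaves : ∀ B ts → fullLeaves B ts ⊆ leavesL ts
fullLeaves-⊆-leaves B (t ∷ ts) y∈ with expected B t ≟ nLeaves t
... | no _ = ∈-++⁺ʳ (leaves t) (fullLeaves-⊆-leaves B ts y∈)
... | yes _ with ∈-++⁻ (leaves t) y∈
...   | inj₁ y∈t    = ∈-++⁺ˡ y∈t
...   | inj₂ y∈rest = ∈-++⁺ʳ (leaves t) (fullLeaves-⊆-leaves B ts y∈rest)

fullLeaves-⊆ : ∀ B ts → fullLeaves B ts ⊆ B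
fullLeaves-⊆ B (t ∷ ts) y∈ with expected B t ≟ nLeaves t
... | no _ = fullLeaves-⊆ B ts y∈
... | yes full with ∈-++⁻ (leaves t) y∈
...   | inj₁ y∈t    = full⇒⊆ B t full y∈t
...   | inj₂ y∈rest = fullLeaves-⊆ B ts y∈rest

fullLeaves-unique : ∀ B ts → Unique (leavesL ts) → Unique (fullLeaves B ts)
fullLeaves-unique B []       u = []
fullLeaves-unique B (t ∷ ts) u with expected B t ≟ nLeaves t
... | yes _ = UniqueP.++⁺ (unique-++ˡ (leaves t) u) (fullLeaves-unique B ts (unique-++ʳ (leaves t) u))
                (λ (y∈t , y∈rest) → unique-++-apart (leaves t) u y∈t (fullLeaves-⊆-leaves B ts y∈rest))
... | no  _ = fullLeaves-unique B ts (unique-++ʳ (leaves t) u)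

fullLeaves-complete : ∀ B ts i {c} → subL ts i [] ≡ just c → expected B c ≡ nLeaves c →
                      leaves c ⊆ fullLeaves B ts
fullLeaves-complete B (t ∷ ts) zero refl full y∈ with expected B t ≟ nLeaves t
... | yes _       = ∈-++⁺ˡ y∈
... | no partial = ⊥-elim (partial full)
fullLeaves-complete B (t ∷ ts) (suc i) ce full y∈ with expected B t ≟ nLeaves t
... | yes _ = ∈-++⁺ʳ (leaves t) (fullLeaves-complete B ts i ce full y∈)
... | no  _ = fullLeaves-complete B ts i ce full y∈

fullLeaves-miss : ∀ B ts i {c y} → Unique (leavesL ts) → subL ts i [] ≡ just c →
                  expected B c ≢ nLeaves c → y ∈ leaves c → y ∉ fullLeaves B ts
fullLeaves-miss B (t ∷ ts) zero u refl partial y∈c y∈ with expected B t ≟ nLeaves t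
... | yes full = partial full
... | no  _    = unique-++-apart (leaves t) u y∈c (fullLeaves-⊆-leaves B ts y∈)
fullLeaves-miss B (t ∷ ts) (suc i) u ce partial y∈c y∈ with expected B t ≟ nLeaves t
... | no _ = fullLeaves-miss B ts i (unique-++ʳ (leaves t) u) ce partial y∈c y∈
... | yes _ with ∈-++⁻ (leaves t) y∈
...   | inj₁ y∈t    = unique-++-apart (leaves t) u y∈t (subL-leaves ts i [] ce y∈c)
...   | inj₂ y∈rest = fullLeaves-miss B ts i (unique-++ʳ (leaves t) u) ce partial y∈c y∈rest

-- UpdateCounterLeaf maintains the predicted counters

CounterInv : Tree → List ℕ → Counter → Set
CounterInv t B c = ∀ w s → sub t w ≡ just s → c w ≡ expected B s

module AddLeaf (t : Tree) (ut : Unique (leaves t)) (a : ℕ) (A : List ℕ) (a∉A : a ∉ A) where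

  A′ : List ℕ
  A′ = a ∷ A

  partial-before : ∀ s → a ∈ leaves s → expected A s ≢ nLeaves s
  partial-before s a∈s full = a∉A (full⇒⊆ A s full a∈s)

  expectedL-growth : ∀ ts i {c} → subL ts i [] ≡ just c → a ∈ leaves c → Unique (leavesL ts) →
                     expectedL A′ ts ≡ expectedL A ts + credit (expected A′ c) (nLeaves c)
  expectedL-growth (t ∷ ts) zero refl a∈t u = begin
      credit (expected A′ t) (nLeaves t) + expectedL A′ ts
        ≡⟨ cong (credit (expected A′ t) (nLeaves t) +_)
                (expected-fresh A a (node ts) (unique-++-apart (leaves t) u a∈t)) ⟩
      credit (expected A′ t) (nLeaves t) + expectedL A ts
        ≡⟨ +-comm (credit (expected A′ t) (nLeaves t)) (expectedL A ts) ⟩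
      expectedL A ts + credit (expected A′ t) (nLeaves t)
        ≡⟨ cong (λ k → (k + expectedL A ts) + credit (expected A′ t) (nLeaves t))
                (sym (credit-partial (partial-before t a∈t))) ⟩
      (credit (expected A t) (nLeaves t) + expectedL A ts) + credit (expected A′ t) (nLeaves t) ∎
    where open ≡-Reasoning
  expectedL-growth (t ∷ ts) (suc i) {c} ce a∈c u = begin
      credit (expected A′ t) (nLeaves t) + expectedL A′ ts
        ≡⟨ cong₂ _+_ (cong (λ f → credit f (nLeaves t)) (expected-fresh A a t a∉t))
                     (expectedL-growth ts i ce a∈c (unique-++ʳ (leaves t) u)) ⟩
      credit (expected A t) (nLeaves t) + (expectedL A ts + credit (expected A′ c) (nLeaves c))
        ≡⟨ sym (+-assoc (credit (expected A t) (nLeaves t)) _ _) ⟩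
      (credit (expected A t) (nLeaves t) + expectedL A ts) + credit (expected A′ c) (nLeaves c) ∎
    where
    open ≡-Reasoning
    a∉t : a ∉ leaves t
    a∉t a∈t = unique-++-apart (leaves t) u a∈t (subL-leaves ts i [] ce a∈c)

  ancestor-unchanged : ∀ s j r {x} → sub s (j ∷ r) ≡ just x → Unique (leaves s) → a ∈ leaves x →
                       expected A′ x ≢ nLeaves x → expected A′ s ≡ expected A s
  ancestor-unchanged s j r {x} e u a∈x x-partial with sub-++⁻ s [ j ] r e
  ... | c , ce , xe with child-of-node s j ce
  ... | ts , refl , ce′ =
    trans (expectedL-growth ts j ce′ (sub-leaves c r xe a∈x) u)
          (trans (cong (expectedL A ts +_) (credit-partial c-partial)) (+-identityʳ (expectedL A ts)))
    where
    c-partial : expected A′ c ≢ nLeaves c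
    c-partial full = x-partial (⊆⇒full A′ x (full⇒⊆ A′ c full ∘ sub-leaves c r xe))

  -- Counters while UpdateCounterLeaf climbs from the new leaf, currently at x:
  -- proper ancestors of x still hold the old values, all other vertices the new ones.
  record ClimbInv (x : Path) (c : Counter) : Set where
    field
      updated  : ∀ w s → sub t w ≡ just s → ProperAncestor w x ⊎ c w ≡ expected A′ s
      outdated : ∀ w s → sub t w ≡ just s → ProperAncestor w x → c w ≡ expected A s

  climb-current : ∀ {x c s} → ClimbInv x c → sub t x ≡ just s → c x ≡ expected A′ s
  climb-current {x} inv xe with ClimbInv.updated inv x _ xe
  ... | inj₁ above = ⊥-elim (proper-irrefl x above)
  ... | inj₂ cx    = cx

  climb-start : ∀ v c → sub t v ≡ just (leaf a) → CounterInv t A c → ClimbInv v (setC c v 1)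
  climb-start v c ve inv = record { updated = updated ; outdated = outdated }
    where
    updated : ∀ w s → sub t w ≡ just s → ProperAncestor w v ⊎ setC c v 1 w ≡ expected A′ s
    updated w s e with ≡-dec _≟_ w v
    ... | yes refl with just-injective (trans (sym e) ve)
    ...   | refl = inj₂ (sym (⊆⇒full A′ (leaf a) λ { (here refl) → here refl }))
    updated w s e | no w≢v with a ∈? leaves s
    ... | no a∉s  = inj₂ (trans (inv w s e) (sym (expected-fresh A a s a∉s)))
    ... | yes a∈s with leaf-path s a∈s
    ...   | q , qe = inj₁ (below q (leaf-path-unique t (w ++ q) v ut (trans (sub-++ t w q e) qe) ve))
      where
      below : ∀ q → w ++ q ≡ v → ProperAncestor w v
      below []      wq≡v = ⊥-elim (w≢v (trans (sym (++-identityʳ w)) wq≡v))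
      below (j ∷ r) wq≡v = j , r , wq≡v
    outdated : ∀ w s → sub t w ≡ just s → ProperAncestor w v → setC c v 1 w ≡ expected A s
    outdated w s e above = trans (setC-other c v 1 w λ { refl → proper-irrefl w above }) (inv w s e)

  climb-step : ∀ p i q c {x} → q ≡ p ++ [ i ] → sub t q ≡ just x → a ∈ leaves x →
               c q ≡ size t q → ClimbInv q c →
               ∃ λ y → sub t p ≡ just y × a ∈ leaves y × ClimbInv p (setC c p (c p + c q))
  climb-step p i .(p ++ [ i ]) c {x} refl xe a∈x q-full inv with sub-++⁻ t p [ i ] xe
  ... | y , ye , ce with child-of-node y i ce
  ... | ts , refl , ce′ =
    node ts , ye , sub-leaves (node ts) [ i ] ce a∈x , record { updated = updated′ ; outdated = outdated′ }
    where
    open ClimbInv inv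
    q : Path
    q = p ++ [ i ]
    cq : c q ≡ expected A′ x
    cq = climb-current inv xe
    x-full : expected A′ x ≡ nLeaves x
    x-full = trans (sym cq) (trans q-full (cong length (L-sub t q xe)))
    cp : c p + c q ≡ expected A′ (node ts)
    cp = begin
      c p + c q                                 ≡⟨ cong₂ _+_ (outdated p (node ts) ye (i , [] , refl)) cq ⟩
      expected A (node ts) + expected A′ x      ≡⟨ cong (expected A (node ts) +_) (sym (credit-full x-full)) ⟩
      expectedL A ts + credit (expected A′ x) (nLeaves x)
                                                ≡⟨ sym (expectedL-growth ts i ce′ a∈x (sub-unique t p ye ut)) ⟩
      expected A′ (node ts)                     ∎
      where open ≡-Reasoning
    updated′ : ∀ w s → sub t w ≡ just s → ProperAncestor w p ⊎ setC c p (c p + c q) w ≡ expected A′ s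
    updated′ w s e with ≡-dec _≟_ w p
    ... | yes refl with just-injective (trans (sym e) ye)
    ...   | refl = inj₂ cp
    updated′ w s e | no w≢p with updated w s e
    ... | inj₂ cw    = inj₂ cw
    ... | inj₁ above with proper-snoc⁻ w p above
    ...   | inj₁ w≡p    = ⊥-elim (w≢p w≡p)
    ...   | inj₂ above′ = inj₁ above′
    outdated′ : ∀ w s → sub t w ≡ just s → ProperAncestor w p → setC c p (c p + c q) w ≡ expected A s
    outdated′ w s e above =
      trans (setC-other c p _ w λ { refl → proper-irrefl w above }) (outdated w s e (proper-snoc⁺ w p above))

  -- the loop stops at a partial vertex q; then nothing above q changes
  climb-stop : ∀ q c {x} → sub t q ≡ just x → a ∈ leaves x → c q ≢ size t q → ClimbInv q c →
               CounterInv t A′ c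
  climb-stop q c {x} xe a∈x q-partial inv w s e with ClimbInv.updated inv w s e
  ... | inj₂ cw = cw
  ... | inj₁ (j , r , wq≡q) =
    trans (ClimbInv.outdated inv w s e (j , r , wq≡q))
          (sym (ancestor-unchanged s j r below (sub-unique t w e ut) a∈x x-partial))
    where
    below : sub s (j ∷ r) ≡ just x
    below = trans (sym (sub-++ t w (j ∷ r) e)) (trans (cong (sub t) wq≡q) xe)
    x-partial : expected A′ x ≢ nLeaves x
    x-partial full = q-partial (trans (climb-current inv xe) (trans full (sym (cong length (L-sub t q xe)))))

  climb-correct : ∀ rp c {x} → sub t (reverse rp) ≡ just x → a ∈ leaves x → ClimbInv (reverse rp) c →
                  CounterInv t A′ (proj₂ (climb t rp c))
  climb-correct [] c _ _ inv w s e with ClimbInv.updated inv w s e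
  ... | inj₁ above = ⊥-elim (no-proper-ancestor-of-root above)
  ... | inj₂ cw    = cw
  climb-correct (i ∷ rp) c xe a∈x inv with c (reverse (i ∷ rp)) ≟ size t (reverse (i ∷ rp))
  ... | no  partial = climb-stop (reverse (i ∷ rp)) c xe a∈x partial inv
  ... | yes full with climb-step (reverse rp) i (reverse (i ∷ rp)) c (unfold-reverse i rp) xe a∈x full inv
  ...   | y , ye , a∈y , inv′ = climb-correct rp _ ye a∈y inv′

  leaf-correct : ∀ v c → sub t v ≡ just (leaf a) → CounterInv t A c →
                 CounterInv t A′ (proj₂ (UpdateCounterLeaf t v c))
  leaf-correct v c ve inv =
    climb-correct (reverse v) (setC c v 1)
      (subst (λ q → sub t q ≡ just (leaf a)) (sym (reverse-involutive v)) ve) (here refl)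
      (subst (λ q → ClimbInv q (setC c v 1)) (sym (reverse-involutive v)) (climb-start v c ve inv))

mutual
  leafPos-sound : ∀ s a {v} → leafPos s a ≡ just v → sub s v ≡ just (leaf a)
  leafPos-sound (leaf b)  a e with b ≟ a
  leafPos-sound (leaf b)  a refl | yes refl = refl
  leafPos-sound (leaf b)  a ()   | no _
  leafPos-sound (node ts) a e with leafPosL-sound ts 0 a e
  ... | j , p , refl , pe = pe

  leafPosL-sound : ∀ ts i a {v} → leafPosL ts i a ≡ just v →
                   ∃₂ λ j p → v ≡ (i + j) ∷ p × subL ts j p ≡ just (leaf a)
  leafPosL-sound (t ∷ ts) i a e with leafPos t a in found
  leafPosL-sound (t ∷ ts) i a refl | just p =
    0 , p , cong (_∷ p) (sym (+-identityʳ i)) , leafPos-sound t a found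
  leafPosL-sound (t ∷ ts) i a e | nothing with leafPosL-sound ts (suc i) a e
  ... | j , p , refl , pe = suc j , p , cong (_∷ p) (sym (+-suc i j)) , pe

mutual
  leafPos-complete : ∀ s a → a ∈ leaves s → leafPos s a ≢ nothing
  leafPos-complete (leaf b)  a (here refl) e with b ≟ b
  leafPos-complete (leaf b)  a (here refl) () | yes _
  ... | no b≢b = b≢b refl
  leafPos-complete (node ts) a a∈ e = leafPosL-complete ts 0 a a∈ e

  leafPosL-complete : ∀ ts i a → a ∈ leavesL ts → leafPosL ts i a ≢ nothing
  leafPosL-complete (t ∷ ts) i a a∈ e with leafPos t a in found
  leafPosL-complete (t ∷ ts) i a a∈ () | just _
  ... | nothing with ∈-++⁻ (leaves t) a∈
  ...   | inj₁ a∈t  = leafPos-complete t a a∈t found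
  ...   | inj₂ a∈ts = leafPosL-complete ts (suc i) a a∈ts e

addLeaf : Tree → Counter → ℕ → Counter
addLeaf t c x = UpdateCounterSubtree t (leaf x) c

addLeaf-correct : ∀ t → Unique (leaves t) → ∀ A x c → x ∈ leaves t → x ∉ A →
                  CounterInv t A c → CounterInv t (x ∷ A) (addLeaf t c x)
addLeaf-correct t ut A x c x∈t x∉A inv with leafPos t x in found
... | just v  = AddLeaf.leaf-correct t ut x A x∉A v c (leafPos-sound t x found) inv
... | nothing = ⊥-elim (leafPos-complete t x x∈t found)

addLeaves-correct : ∀ t → Unique (leaves t) → ∀ xs A c → Unique xs → Disjoint xs A → xs ⊆ leaves t →
                    CounterInv t A c → CounterInv t (xs ʳ++ A) (foldl (addLeaf t) c xs)
addLeaves-correct t ut []       A c _          _     _     inv = inv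
addLeaves-correct t ut (x ∷ xs) A c (x∉xs ∷ u) apart xs⊆t inv =
  addLeaves-correct t ut xs (x ∷ A) (addLeaf t c x) u apart′ (xs⊆t ∘ there)
    (addLeaf-correct t ut A x c (xs⊆t (here refl)) (λ x∈A → apart (here refl , x∈A)) inv)
  where
  apart′ : Disjoint xs (x ∷ A)
  apart′ (y∈xs , here refl)  = All-lookup x∉xs y∈xs refl
  apart′ (y∈xs , there y∈A) = apart (there y∈xs , y∈A)

subtree-counters : ∀ t u → Unique (leaves t) → Unique (leaves u) → leaves u ⊆ leaves t →
                   CounterInv t (leaves u) (UpdateCounterSubtree t u ClearCounter)
subtree-counters t u ut uu u⊆t w s e =
  trans (addLeaves-correct t ut (leaves u) [] ClearCounter uu (λ ()) u⊆t cleared w s e)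
        (expected-cong (reverse (leaves u)) (leaves u) s (λ _ → reverse⁻) (λ _ → reverse⁺))
  where
  cleared : CounterInv t [] ClearCounter
  cleared _ s _ = sym (expected-[] s)

-- The counting criterion

Splits : List ℕ → List ℕ → Set
Splits S X = Disjoint X S ⊎ X ⊆ S

Splits-⊆ : ∀ {S X Y} → Y ⊆ X → Splits S X → Splits S Y
Splits-⊆ Y⊆X (inj₁ X∩S=∅) = inj₁ λ (y∈Y , y∈S) → X∩S=∅ (Y⊆X y∈Y , y∈S)
Splits-⊆ Y⊆X (inj₂ X⊆S)   = inj₂ (X⊆S ∘ Y⊆X)

ChildrenSplit : List ℕ → Tree → Set
ChildrenSplit S s = ∀ i {c} → sub s [ i ] ≡ just c → Splits S (leaves c)

leaf-count : ∀ S b → Unique S → S ⊆ [ b ] → expected S (leaf b) ≡ length S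
leaf-count S b uS S⊆b with b ∈? S
... | yes b∈S = unique-⊆⊇⇒length≡ [ b ] S (All.[] ∷ []) uS (λ { (here refl) → b∈S }) S⊆b
... | no  b∉S = sym (n≤0⇒n≡0 (unique-⊆⇒length≤ S [] uS S-empty))
  where
  S-empty : S ⊆ []
  S-empty y∈S with S⊆b y∈S
  ... | here refl = ⊥-elim (b∉S y∈S)

split⇔full-count : ∀ S s → Unique (leaves s) → Unique S → S ⊆ leaves s →
                   ChildrenSplit S s ⇔ (expected S s ≡ length S)
split⇔full-count S (leaf b)  _ uS S⊆s = mk⇔ (λ _ → leaf-count S b uS S⊆s) (λ _ i ())
split⇔full-count S (node ts) u uS S⊆s = mk⇔ split⇒count count⇒split
  where
  fl : List ℕ
  fl = fullLeaves S ts

  split⇒count : ChildrenSplit S (node ts) → expectedL S ts ≡ length S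
  split⇒count split =
    trans (expectedL≡length-fullLeaves S ts)
          (unique-⊆⊇⇒length≡ fl S (fullLeaves-unique S ts u) uS (fullLeaves-⊆ S ts) S⊆fl)
    where
    S⊆fl : S ⊆ fl
    S⊆fl y∈S with child-containing ts (S⊆s y∈S)
    ... | i , c , ce , y∈c with split i ce
    ...   | inj₁ c∩S=∅ = ⊥-elim (c∩S=∅ (y∈c , y∈S))
    ...   | inj₂ c⊆S   = fullLeaves-complete S ts i ce (⊆⇒full S c c⊆S) y∈c

  -- a partial child meeting S would leave a leaf of S uncounted
  count⇒split : expectedL S ts ≡ length S → ChildrenSplit S (node ts)
  count⇒split count i {c} ce with expected S c ≟ nLeaves c
  ... | yes full    = inj₂ (full⇒⊆ S c full)
  ... | no  partial = inj₁ λ (y∈c , y∈S) →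
    <-irrefl refl (≤-trans (more y∈c y∈S) (≤-reflexive (trans (sym count) (expectedL≡length-fullLeaves S ts))))
    where
    more : ∀ {y} → y ∈ leaves c → y ∈ S → suc (length fl) ≤ length S
    more {y} y∈c y∈S = unique-⊆⇒length≤ (y ∷ fl) S
      (All-tabulate (λ z∈fl y≡z → fullLeaves-miss S ts i u ce partial y∈c (subst (_∈ fl) (sym y≡z) z∈fl))
        ∷ fullLeaves-unique S ts u)
      (λ { (here refl) → y∈S ; (there z∈fl) → fullLeaves-⊆ S ts z∈fl })

-- Compatibility and the least common ancestor

ChildCondition : Tree → List ℕ → Path → Set
ChildCondition t S w = ∀ i → IsVertex t (w ++ [ i ]) → Splits S (L t (w ++ [ i ]))

children-split⁺ : ∀ t S w {s} → sub t w ≡ just s → ChildrenSplit S s → ChildCondition t S w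
children-split⁺ t S w we split i (c , ce) =
  subst (Splits S) (sym (L-sub t (w ++ [ i ]) ce)) (split i (trans (sym (sub-++ t w [ i ] we)) ce))

children-split⁻ : ∀ t S w {s} → sub t w ≡ just s → ChildCondition t S w → ChildrenSplit S s
children-split⁻ t S w {s} we cond i {c} ce = subst (Splits S) (L-sub t (w ++ [ i ]) ce′) (cond i (_ , ce′))
  where ce′ : sub t (w ++ [ i ]) ≡ just c
        ce′ = trans (sub-++ t w [ i ] we) ce

covering-common-ancestor : ∀ t S w {s} → Unique (leaves t) → sub t w ≡ just s → S ⊆ leaves s →
                           IsCommonAncestor t S w
covering-common-ancestor t S w {s} ut we S⊆s = (s , we) , λ a p a∈S pe →
  let q , qe = leaf-path s (S⊆s a∈S)
  in q , leaf-path-unique t (w ++ q) p ut (trans (sub-++ t w q we) qe) pe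

lca-covers : ∀ t S z {x} → IsLCA t S z → sub t z ≡ just x → S ⊆ leaves t → S ⊆ leaves x
lca-covers t S z ((_ , below-z) , _) ze S⊆t {a} a∈S with leaf-path t (S⊆t a∈S)
... | p , pe with below-z a p a∈S pe
... | r , zr≡p = sub-leaves _ r (trans (sym (sub-++ t z r ze)) (trans (cong (sub t) zr≡p) pe)) (here refl)

-- S is compatible with t iff no child of its lca straddles S: a witness strictly
-- above the lca has a child containing the lca, which passes its split down.
compatible⇔split : ∀ t S z {x} → Unique (leaves t) → IsLCA t S z → sub t z ≡ just x → S ⊆ leaves x →
                   Compatible S t ⇔ ChildrenSplit S x
compatible⇔split t S z {x} ut lca ze S⊆x = mk⇔ to from
  where
  to : Compatible S t → ChildrenSplit S x
  to (w , (s , we) , S⊆Lw , cond) with proj₂ lca w (covering-common-ancestor t S w ut we S⊆s)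
    where S⊆s : S ⊆ leaves s
          S⊆s = subst (S ⊆_) (L-sub t w we) S⊆Lw
  ... | r , wr≡z = go r (trans (sym (sub-++ t w r we)) (trans (cong (sub t) wr≡z) ze))
    where
    go : ∀ r → sub s r ≡ just x → ChildrenSplit S x
    go []      refl = children-split⁻ t S w we cond
    go (j ∷ r) sx with sub-++⁻ s [ j ] r sx
    ... | cj , cje , xe = λ i ce →
      Splits-⊆ (sub-leaves cj r xe ∘ sub-leaves x [ i ] ce) (children-split⁻ t S w we cond j cje)

  from : ChildrenSplit S x → Compatible S t
  from split = z , (x , ze) , subst (S ⊆_) (sym (L-sub t z ze)) S⊆x , children-split⁺ t S z ze split

mainTheorem3 : (T t' : Tree) → WF T → WF t' →
    Unique (leaves T) → Unique (leaves t') → leaves T ↭ leaves t' →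
    (u : Path) (tu : Tree) → sub T u ≡ just tu →
    (z' : Path) → IsLCA t' (leaves tu) z' →
    Compatible (leaves tu) t' ⇔ (UpdateCounterSubtree t' tu ClearCounter z' ≡ length (leaves tu))
mainTheorem3 T t' _ _ uT ut' perm u tu tue z' lca@(((x , ze) , _) , _) =
  ⇔.trans (compatible⇔split t' S z' ut' lca ze S⊆x)
          (⇔.trans (split⇔full-count S x (sub-unique t' z' ze ut') uS S⊆x) counter-at-lca)
  where
  S : List ℕ
  S = leaves tu
  uS : Unique S
  uS = sub-unique T u tue uT
  S⊆t′ : S ⊆ leaves t'
  S⊆t′ = ∈-resp-↭ perm ∘ sub-leaves T u tue
  S⊆x : S ⊆ leaves x
  S⊆x = lca-covers t' S z' lca ze S⊆t′
  counter≡ : UpdateCounterSubtree t' tu ClearCounter z' ≡ expected S x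
  counter≡ = subtree-counters t' tu ut' uS S⊆t′ z' x ze
  counter-at-lca : (expected S x ≡ length S) ⇔ (UpdateCounterSubtree t' tu ClearCounter z' ≡ length S)
  counter-at-lca = mk⇔ (trans counter≡) (trans (sym counter≡))
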